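{- Let $G$ be an abelian group with a direct sum decomposition $G=\mathbb Z\oplus H$, where $\mathbb Z$ denotes an infinite cyclic subgroup and $H<G$ is finite, and let $\psi\colon G\to\mathbb Z$ be the projection along $H$. Let $A_1,A_2\subseteq G$ be finite nonempty subsets and put $n_i:=|\psi(A_i)|$ for $i\in\{1,2\}$. Then $$|2A_1|+|A_1+A_2|+|2A_2|\ge 3\Big(1-\frac1{n_1+n_2}\Big)(|A_1|+|A_2|).$$
   Context: For subsets $X,Y$ of an abelian group, $X+Y=\{x+y\colon x\in X,\ y\in Y\}$ and $2X=X+X$. -}

module Defs where

open import Level using (Level)
open import Algebra.Bundles using (AbelianGroup)
open import Data.Nat using (ℕ; zero; suc)
open import Data.Integer as ℤ using (ℤ)
open import Data.Product using (_×_; _,_; proj₁; proj₂)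
open import Data.List using (List; []; _∷_; map; concatMap)
open import Data.List.Relation.Unary.Any using (Any; any?)
open import Relation.Binary.Core using (Rel)
open import Relation.Binary.Definitions using (Decidable)
open import Relation.Binary.PropositionalEquality using (_≡_)
open import Relation.Nullary using (yes; no)
open import Relation.Nullary.Decidable using (_×-dec_)

-- Number of pairwise distinct elements (w.r.t. a decidable relation _≈_)
-- of a finite list; i.e. the cardinality of the finite set the list represents.
distinctCount : ∀ {a ℓ} {A : Set a} {_≈_ : Rel A ℓ} → Decidable _≈_ → List A → ℕ
distinctCount dec [] = 0
distinctCount dec (x ∷ xs) with any? (dec x) xs
... | yes _ = distinctCount dec xs
... | no  _ = suc (distinctCount dec xs)

module Sum {c ℓ : Level} (H : AbelianGroup c ℓ) where
  open AbelianGroup H renaming (Carrier to H₀; _∙_ to _+H_; _≈_ to _≈H_)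

  G : Set c
  G = ℤ × H₀

  _≈G_ : G → G → Set ℓ
  (a , h) ≈G (b , k) = (a ≡ b) × (h ≈H k)

  _⊕_ : G → G → G
  (a , h) ⊕ (b , k) = (a ℤ.+ b , h +H k)

  ψ : G → ℤ
  ψ = proj₁

  sumset : List G → List G → List G
  sumset X Y = concatMap (λ x → map (x ⊕_) Y) X

  module Card (_≟H_ : Decidable _≈H_) where
    _≟G_ : Decidable _≈G_
    (a , h) ≟G (b , k) = (a ℤ.≟ b) ×-dec (h ≟H k)

    ∣_∣ : List G → ℕ
    ∣ X ∣ = distinctCount _≟G_ X

    ∣ψ_∣ : List G → ℕ
    ∣ψ X ∣ = distinctCount ℤ._≟_ (map ψ X)

-- Fix a level k ∈ ℤ and let X_k be the part of X lying over k. For nonempty Y,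
--   |X + Y| ≥ |X| + (|ψ(Y)| − 1)|X_k|,
-- since the parts of X below, at and above level k can be translated by suitable elements of Y
-- into pairwise disjoint pieces of X + Y. Choosing k with X_k of maximal size α gives
-- |X| ≤ |ψ(X)| α. Applying the bound to A₁ + A₁, A₁ + A₂ and A₂ + A₂ (the middle sumset once
-- with the largest fibre of A₁ and once with that of A₂) and assuming by symmetry that the
-- largest fibre of A₂ is no larger than that of A₁, the claim follows by elementary arithmetic.

module Submission where

open import Defs
open import Algebra.Bundles using (AbelianGroup)
import Algebra.Construct.DirectProduct as DirectProduct
import Algebra.Properties.AbelianGroup as AbelianGroupProperties
open import Data.Integer as ℤ using (ℤ)
import Data.Integer.Properties as ℤP
open import Data.List using (List; []; _∷_; map; filter; length; concatMap; cartesianProductWith; _++_)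
open import Data.List.Properties using (length-filter; length-map; length-++; filter-notAll)
import Data.List.Extrema as Extrema
import Data.List.Extrema.Nat as ℕExtrema
open import Data.List.Relation.Unary.All using (All; universal; lookupₛ)
import Data.List.Relation.Unary.All.Properties as Allₚ
open import Data.List.Relation.Unary.Any as Any using (Any; here; there; any?)
import Data.List.Relation.Unary.Any.Properties as Anyₚ
import Data.List.Relation.Unary.AllPairs as AllPairs
import Data.List.Relation.Unary.AllPairs.Properties as AllPairsₚ
open import Data.Nat using (ℕ; zero; suc; _+_; _*_; _∸_; _≤_; z≤n)
open import Data.Nat.Properties
  using (≤-trans; ≤-reflexive; ≤-total; +-suc; *-identityˡ; *-distribʳ-+; +-mono-≤; +-monoˡ-≤; +-monoʳ-≤;
         *-monoʳ-≤; +-cancelʳ-≤; m+[n∸m]≡n; module ≤-Reasoning)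
open import Data.Nat.Tactic.RingSolver using (solve-∀; solve)
open import Data.Product using (Σ; ∃; ∃₂; _×_; _,_; proj₁; proj₂)
open import Data.Sum using (_⊎_; inj₁; inj₂; [_,_]′)
open import Function using (_∘_)
open import Level using (Level)
import Relation.Binary.Construct.On as On
open import Relation.Binary.Bundles using (DecSetoid)
open import Relation.Binary.Core using (Rel)
open import Relation.Binary.Definitions using (Decidable; _Respects_; tri<; tri≈; tri>)
open import Relation.Binary.PropositionalEquality
  using (_≡_; _≢_; refl; sym; trans; cong; cong₂; subst; subst₂; module ≡-Reasoning)
open import Relation.Nullary using (yes; no; ¬_; ¬?; contradiction)
import Relation.Unary as U

private
  variable
    a b ℓ : Level

distinctCount-map : ∀ {A : Set a} {B : Set b} {_≈_ : Rel B ℓ} (_≟_ : Decidable _≈_) (f : A → B) xs →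
                    distinctCount _≟_ (map f xs) ≡ distinctCount (λ x y → f x ≟ f y) xs
distinctCount-map _≟_ f [] = refl
distinctCount-map _≟_ f (x ∷ xs)
  with any? (f x ≟_) (map f xs) | any? (λ y → f x ≟ f y) xs
... | yes _ | yes _ = distinctCount-map _≟_ f xs
... | no  _ | no  _ = cong suc (distinctCount-map _≟_ f xs)
... | yes p | no ¬q = contradiction (Anyₚ.map⁻ p) ¬q
... | no ¬p | yes q = contradiction (Anyₚ.map⁺ q) ¬p

module Cardinality (S : DecSetoid a ℓ) where

  open AllPairs using ([]; _∷_)
  open DecSetoid S using (Carrier; _≈_; _≟_; setoid) renaming (refl to ≈-refl; sym to ≈-sym; trans to ≈-trans)
  open import Data.List.Membership.Setoid.Properties using (∈-filter⁺; ∈-resp-≈; ∉⇒All[≉]; ∈-length)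
  open import Data.List.Relation.Binary.Subset.Setoid setoid using (_⊆_)
  open import Data.List.Relation.Unary.Unique.Setoid setoid using (Unique)
  open import Data.List.Relation.Unary.Unique.Setoid.Properties using (Unique[x∷xs]⇒x∉xs)

  distinct : List Carrier → List Carrier
  distinct [] = []
  distinct (x ∷ xs) with any? (x ≟_) xs
  ... | yes _ = distinct xs
  ... | no  _ = x ∷ distinct xs

  length-distinct : ∀ xs → length (distinct xs) ≡ distinctCount _≟_ xs
  length-distinct [] = refl
  length-distinct (x ∷ xs) with any? (x ≟_) xs
  ... | yes _ = length-distinct xs
  ... | no  _ = cong suc (length-distinct xs)

  distinct⁻ : ∀ {p} {P : Carrier → Set p} xs → Any P (distinct xs) → Any P xs
  distinct⁻ (x ∷ xs) p with any? (x ≟_) xs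
  distinct⁻ (x ∷ xs) p         | yes _ = there (distinct⁻ xs p)
  distinct⁻ (x ∷ xs) (here p)  | no  _ = here p
  distinct⁻ (x ∷ xs) (there p) | no  _ = there (distinct⁻ xs p)

  distinct⁺ : ∀ xs → xs ⊆ distinct xs
  distinct⁺ (x ∷ xs) z∈x∷xs with any? (x ≟_) xs
  distinct⁺ (x ∷ xs) (here z≈x)  | yes x∈xs = distinct⁺ xs (∈-resp-≈ setoid (≈-sym z≈x) x∈xs)
  distinct⁺ (x ∷ xs) (there z∈xs) | yes _ = distinct⁺ xs z∈xs
  distinct⁺ (x ∷ xs) (here z≈x)  | no  _ = here z≈x
  distinct⁺ (x ∷ xs) (there z∈xs) | no  _ = there (distinct⁺ xs z∈xs)

  distinct-unique : ∀ xs → Unique (distinct xs)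
  distinct-unique [] = []
  distinct-unique (x ∷ xs) with any? (x ≟_) xs
  ... | yes _    = distinct-unique xs
  ... | no x∉xs = ∉⇒All[≉] setoid (x∉xs ∘ distinct⁻ xs) ∷ distinct-unique xs

  unique⇒length≤ : ∀ {xs ys} → Unique xs → xs ⊆ ys → length xs ≤ length ys
  unique⇒length≤ [] _ = z≤n
  unique⇒length≤ {x ∷ xs} {ys} x∷xs! x∷xs⊆ys = begin-strict
    length xs               ≤⟨ unique⇒length≤ (AllPairs.tail x∷xs!) xs⊆ys-x ⟩
    length (filter x≉? ys)  <⟨ filter-notAll x≉? ys (Any.map (λ x≈y x≉y → x≉y x≈y) x∈ys) ⟩
    length ys               ∎
    where
    open ≤-Reasoning
    x≉? : U.Decidable (λ y → ¬ x ≈ y)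
    x≉? y = ¬? (x ≟ y)
    x∈ys = x∷xs⊆ys (here ≈-refl)
    xs⊆ys-x : xs ⊆ filter x≉? ys
    xs⊆ys-x z∈xs =
      ∈-filter⁺ setoid x≉? (λ y≈y′ x≉y x≈y′ → x≉y (≈-trans x≈y′ (≈-sym y≈y′))) (x∷xs⊆ys (there z∈xs))
      (λ x≈z → Unique[x∷xs]⇒x∉xs setoid x∷xs! (∈-resp-≈ setoid (≈-sym x≈z) z∈xs))

  unique⇒length≤distinctCount : ∀ {xs ys} → Unique xs → xs ⊆ ys → length xs ≤ distinctCount _≟_ ys
  unique⇒length≤distinctCount {ys = ys} xs! xs⊆ys =
    subst (_ ≤_) (length-distinct ys) (unique⇒length≤ xs! (distinct⁺ ys ∘ xs⊆ys))

  distinctCount-mono : ∀ {xs ys} → xs ⊆ ys → distinctCount _≟_ xs ≤ distinctCount _≟_ ys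
  distinctCount-mono {xs} xs⊆ys =
    subst (_≤ _) (length-distinct xs) (unique⇒length≤distinctCount (distinct-unique xs) (xs⊆ys ∘ distinct⁻ xs))

  distinctCount-nonempty : ∀ x xs → 1 ≤ distinctCount _≟_ (x ∷ xs)
  distinctCount-nonempty x xs =
    subst (1 ≤_) (length-distinct (x ∷ xs)) (∈-length setoid (distinct⁺ (x ∷ xs) (here ≈-refl)))

module _ {A : Set a} {B : Set b} where

  open Data.List.Relation.Unary.All using ([]; _∷_)

  length-concatMap-≤ : ∀ (f : A → List B) {m} xs → All (λ x → length (f x) ≤ m) xs →
                       length (concatMap f xs) ≤ length xs * m
  length-concatMap-≤ f [] [] = z≤n
  length-concatMap-≤ f (x ∷ xs) (fx≤m ∷ fxs≤m) =
    ≤-trans (≤-reflexive (length-++ (f x))) (+-mono-≤ fx≤m (length-concatMap-≤ f xs fxs≤m))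

  length-concatMap-map : ∀ {C : Set a} (g : A → C → B) ys xs →
                         length (concatMap (λ x → map (g x) ys) xs) ≡ length xs * length ys
  length-concatMap-map g ys [] = refl
  length-concatMap-map g ys (x ∷ xs) =
    trans (length-++ (map (g x) ys)) (cong₂ _+_ (length-map (g x) ys) (length-concatMap-map g ys xs))

private
  coefficient : ∀ a b t → a + b ≡ suc t → t * suc a + (3 + 2 * t + t * b) ≡ (3 + t) * suc t
  coefficient a b t a+b≡1+t = begin
    t * suc a + (3 + 2 * t + t * b) ≡⟨ solve (t ∷ a ∷ b ∷ []) ⟩
    t * suc (a + b) + (3 + 2 * t)   ≡⟨ cong (λ s → t * suc s + (3 + 2 * t)) a+b≡1+t ⟩
    t * suc (suc t) + (3 + 2 * t)   ≡⟨ solve (t ∷ []) ⟩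
    (3 + t) * suc t                 ∎
    where open ≡-Reasoning

  excess-bound : ∀ a b t {A B α β} → a + b ≡ suc t → β ≤ α → A ≤ suc a * α → B ≤ suc b * β →
                 t * A + (3 + 2 * t) * B ≤ (3 + t) * suc t * α + (3 + t) * b * β
  excess-bound a b t {A} {B} {α} {β} a+b≡1+t β≤α A≤ B≤ = begin
    t * A + (3 + 2 * t) * B
      ≤⟨ +-mono-≤ (*-monoʳ-≤ t A≤) (*-monoʳ-≤ (3 + 2 * t) B≤) ⟩
    t * (suc a * α) + (3 + 2 * t) * (suc b * β)
      ≡⟨ solve (t ∷ a ∷ b ∷ α ∷ β ∷ []) ⟩
    t * suc a * α + (3 + 2 * t + t * b) * β + (3 + t) * b * β
      ≤⟨ +-monoˡ-≤ _ (+-monoʳ-≤ (t * suc a * α) (*-monoʳ-≤ (3 + 2 * t + t * b) β≤α)) ⟩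
    t * suc a * α + (3 + 2 * t + t * b) * α + (3 + t) * b * β
      ≡⟨ cong (_+ (3 + t) * b * β) (trans (sym (*-distribʳ-+ α (t * suc a) _))
                                          (cong (_* α) (coefficient a b t a+b≡1+t))) ⟩
    (3 + t) * suc t * α + (3 + t) * b * β
      ∎
    where open ≤-Reasoning

  -- For S = 2A + B + (1 + t)α + bβ, the slack (3 + t)S − 3(2 + t)(A + B) is exactly the
  -- right side minus the left side of excess-bound.
  inequality-if-β≤α-and-a+b≡1+t : ∀ a b t {A B α β} → a + b ≡ suc t → β ≤ α →
    A ≤ suc a * α → B ≤ suc b * β →
    3 * (a + suc b) * (A + B) ≤ (suc a + suc b) * ((A + a * α) + (A + b * α) + (B + b * β))
  inequality-if-β≤α-and-a+b≡1+t a b t {A} {B} {α} {β} a+b≡1+t β≤α A≤ B≤ =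
    +-cancelʳ-≤ (t * A + (3 + 2 * t) * B) (3 * (a + suc b) * (A + B))
      ((suc a + suc b) * ((A + a * α) + (A + b * α) + (B + b * β))) (begin
    3 * (a + suc b) * (A + B) + (t * A + (3 + 2 * t) * B)
      ≡⟨ cong (λ s → 3 * s * (A + B) + (t * A + (3 + 2 * t) * B)) a+1+b≡2+t ⟩
    3 * (2 + t) * (A + B) + (t * A + (3 + 2 * t) * B)
      ≤⟨ +-monoʳ-≤ (3 * (2 + t) * (A + B)) (excess-bound a b t a+b≡1+t β≤α A≤ B≤) ⟩
    3 * (2 + t) * (A + B) + ((3 + t) * suc t * α + (3 + t) * b * β)
      ≡⟨ solve (t ∷ A ∷ B ∷ α ∷ β ∷ b ∷ []) ⟩
    (3 + t) * (2 * A + B + suc t * α + b * β) + (t * A + (3 + 2 * t) * B)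
      ≡⟨ cong₂ (λ s r → suc s * (2 * A + B + r * α + b * β) + (t * A + (3 + 2 * t) * B))
               (sym a+1+b≡2+t) (sym a+b≡1+t) ⟩
    (suc a + suc b) * (2 * A + B + (a + b) * α + b * β) + (t * A + (3 + 2 * t) * B)
      ≡⟨ cong (λ S → (suc a + suc b) * S + (t * A + (3 + 2 * t) * B)) regroup ⟩
    (suc a + suc b) * ((A + a * α) + (A + b * α) + (B + b * β)) + (t * A + (3 + 2 * t) * B)
      ∎)
    where
    open ≤-Reasoning
    a+1+b≡2+t : a + suc b ≡ suc (suc t)
    a+1+b≡2+t = trans (+-suc a b) (cong suc a+b≡1+t)
    regroup : 2 * A + B + (a + b) * α + b * β ≡ (A + a * α) + (A + b * α) + (B + b * β)
    regroup = solve (A ∷ B ∷ α ∷ β ∷ a ∷ b ∷ [])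

  inequality-if-β≤α : ∀ a b {A B α β} → β ≤ α → α ≤ A → A ≤ suc a * α → B ≤ suc b * β →
    3 * (a + suc b) * (A + B) ≤ (suc a + suc b) * ((A + a * α) + (A + b * α) + (B + b * β))
  inequality-if-β≤α zero zero {A} {B} {α} {β} β≤α α≤A _ B≤ = begin
    3 * 1 * (A + B)                               ≡⟨ solve (A ∷ B ∷ []) ⟩
    B + (3 * A + 2 * B)                           ≤⟨ +-monoˡ-≤ _ B≤A ⟩
    A + (3 * A + 2 * B)                           ≡⟨ solve (A ∷ B ∷ α ∷ β ∷ []) ⟩
    2 * ((A + 0 * α) + (A + 0 * α) + (B + 0 * β)) ∎
    where
    open ≤-Reasoning
    B≤A : B ≤ A
    B≤A = ≤-trans B≤ (≤-trans (≤-reflexive (*-identityˡ β)) (≤-trans β≤α α≤A))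
  inequality-if-β≤α zero (suc b) β≤α _ A≤ B≤ =
    inequality-if-β≤α-and-a+b≡1+t zero (suc b) b refl β≤α A≤ B≤
  inequality-if-β≤α (suc a) b β≤α _ A≤ B≤ =
    inequality-if-β≤α-and-a+b≡1+t (suc a) b (a + b) refl β≤α A≤ B≤

three-sumsets-inequality : ∀ {n₁ n₂ A B α β S₁ S₂ S₃} → 1 ≤ n₁ → 1 ≤ n₂ →
  α ≤ A → β ≤ B → A ≤ n₁ * α → B ≤ n₂ * β →
  A + (n₁ ∸ 1) * α ≤ S₁ → A + (n₂ ∸ 1) * α ≤ S₂ →
  B + (n₁ ∸ 1) * β ≤ S₂ → B + (n₂ ∸ 1) * β ≤ S₃ →
  3 * ((n₁ + n₂) ∸ 1) * (A + B) ≤ (n₁ + n₂) * (S₁ + S₂ + S₃)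
three-sumsets-inequality {suc a} {suc b} {A} {B} {α} {β} {S₁} {S₂} {S₃}
                         _ _ α≤A β≤B A≤ B≤ A₁A₁ A₁A₂ A₂A₁ A₂A₂ with ≤-total β α
... | inj₁ β≤α = ≤-trans (inequality-if-β≤α a b β≤α α≤A A≤ B≤)
                   (*-monoʳ-≤ (suc a + suc b) (+-mono-≤ (+-mono-≤ A₁A₁ A₁A₂) A₂A₂))
... | inj₂ α≤β = subst₂ _≤_ swap-lhs swap-rhs
                   (≤-trans (inequality-if-β≤α b a α≤β β≤B B≤ A≤)
                      (*-monoʳ-≤ (suc b + suc a) (+-mono-≤ (+-mono-≤ A₂A₂ A₂A₁) A₁A₁)))
  where
  swap-lhs : 3 * (b + suc a) * (B + A) ≡ 3 * (a + suc b) * (A + B)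
  swap-lhs = solve (a ∷ b ∷ A ∷ B ∷ [])
  swap-rhs : (suc b + suc a) * (S₃ + S₂ + S₁) ≡ (suc a + suc b) * (S₁ + S₂ + S₃)
  swap-rhs = solve (a ∷ b ∷ S₁ ∷ S₂ ∷ S₃ ∷ [])

module SumsetBounds {c ℓ} (G : AbelianGroup c ℓ) (_≟_ : Decidable (AbelianGroup._≈_ G))
  (ψ : AbelianGroup.Carrier G → ℤ)
  (ψ-cong : ∀ {x y} → AbelianGroup._≈_ G x y → ψ x ≡ ψ y)
  (ψ-homo : ∀ x y → ψ (AbelianGroup._∙_ G x y) ≡ ψ x ℤ.+ ψ y) where

  open Data.List.Relation.Unary.All using ([]; _∷_)
  open AbelianGroup G using (Carrier; _≈_; _∙_; setoid; isEquivalence; reflexive; ∙-cong; comm)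
    renaming (sym to ≈-sym; trans to ≈-trans)
  open AbelianGroupProperties G using (∙-cancelʳ)
  open AbelianGroupProperties ℤP.+-0-abelianGroup using () renaming (∙-cancelˡ to ℤ-+-cancelˡ)
  open import Data.List.Membership.Setoid setoid using (_∈_; find)
  open import Data.List.Membership.Propositional using () renaming (_∈_ to _∈ₚ_)
  open import Data.List.Membership.Setoid.Properties
    using (∈-resp-≈; ∈-map⁻; ∈-filter⁺; ∈-filter⁻; ∈-++⁺ˡ; ∈-++⁺ʳ; ∈-++⁻;
           ∈-concatMap⁺; ∈-concatMap⁻; ∈-cartesianProductWith⁺; ∈-cartesianProductWith⁻)
  open import Data.List.Relation.Binary.Subset.Setoid setoid using (_⊆_)
  open import Data.List.Relation.Binary.Disjoint.Setoid setoid using (Disjoint)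
  open import Data.List.Relation.Unary.Unique.Setoid setoid using (Unique)
  import Data.List.Relation.Unary.Unique.Setoid.Properties as Uniqueₚ
  module ℤExtrema = Extrema ℤP.≤-totalOrder

  sumset : List Carrier → List Carrier → List Carrier
  sumset X Y = concatMap (λ x → map (x ∙_) Y) X

  ∣_∣ : List Carrier → ℕ
  ∣ X ∣ = distinctCount _≟_ X

  ∣ψ_∣ : List Carrier → ℕ
  ∣ψ X ∣ = distinctCount ℤ._≟_ (map ψ X)

  Gₛ : DecSetoid c ℓ
  Gₛ = record { isDecEquivalence = record { isEquivalence = isEquivalence ; _≟_ = _≟_ } }

  open Cardinality Gₛ

  module ψ-Cardinality = Cardinality (On.decSetoid ℤP.≡-decSetoid ψ)

  ∣ψ∣≡length : ∀ X → ∣ψ X ∣ ≡ length (ψ-Cardinality.distinct X)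
  ∣ψ∣≡length X = trans (distinctCount-map ℤ._≟_ ψ X) (sym (ψ-Cardinality.length-distinct X))

  sumset≡cartesianProductWith : ∀ X Y → sumset X Y ≡ cartesianProductWith _∙_ X Y
  sumset≡cartesianProductWith [] Y = refl
  sumset≡cartesianProductWith (x ∷ X) Y = cong (map (x ∙_) Y ++_) (sumset≡cartesianProductWith X Y)

  ∈-sumset⁺ : ∀ {x y X Y} → x ∈ X → y ∈ Y → x ∙ y ∈ sumset X Y
  ∈-sumset⁺ {x} {y} {X} {Y} x∈X y∈Y = subst (x ∙ y ∈_) (sym (sumset≡cartesianProductWith X Y))
    (∈-cartesianProductWith⁺ setoid setoid setoid ∙-cong x∈X y∈Y)

  ∈-sumset⁻ : ∀ {z} X Y → z ∈ sumset X Y → ∃₂ λ x y → x ∈ X × y ∈ Y × z ≈ x ∙ y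
  ∈-sumset⁻ {z} X Y z∈X+Y = ∈-cartesianProductWith⁻ setoid setoid setoid _∙_ X Y
    (subst (z ∈_) (sumset≡cartesianProductWith X Y) z∈X+Y)

  sumset-comm-≤ : ∀ X Y → ∣ sumset Y X ∣ ≤ ∣ sumset X Y ∣
  sumset-comm-≤ X Y = distinctCount-mono λ z∈Y+X →
    let y , x , y∈Y , x∈X , z≈y∙x = ∈-sumset⁻ Y X z∈Y+X
    in ∈-resp-≈ setoid (≈-sym (≈-trans z≈y∙x (comm y x))) (∈-sumset⁺ x∈X y∈Y)

  fibre : ℤ → List Carrier → List Carrier
  fibre k X = filter ((ℤ._≟ k) ∘ ψ) (distinct X)

  ψ-resp : ∀ {p} (Q : ℤ → Set p) → (Q ∘ ψ) Respects _≈_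
  ψ-resp Q x≈y = subst Q (ψ-cong x≈y)

  length-fibre≤ : ∀ k X → length (fibre k X) ≤ ∣ X ∣
  length-fibre≤ k X = ≤-trans (length-filter _ (distinct X)) (≤-reflexive (length-distinct X))

  largest-fibre : ∀ x xs → ∃ λ k → ∣ x ∷ xs ∣ ≤ ∣ψ x ∷ xs ∣ * length (fibre k (x ∷ xs))
  largest-fibre x xs = ψ r* , (begin
      ∣ X ∣                                       ≡⟨ sym (length-distinct X) ⟩
      length (distinct X)                         ≤⟨ unique⇒length≤ (distinct-unique X) covered ⟩
      length (concatMap (λ r → fibre (ψ r) X) R)  ≤⟨ length-concatMap-≤ _ R (ℕExtrema.f[xs]≤f[argmax] x R) ⟩
      length R * size r*                          ≡⟨ cong (_* size r*) (sym (∣ψ∣≡length X)) ⟩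
      ∣ψ X ∣ * size r*                            ∎)
    where
    open ≤-Reasoning
    X = x ∷ xs
    R = ψ-Cardinality.distinct X
    size : Carrier → ℕ
    size r = length (fibre (ψ r) X)
    r* = ℕExtrema.argmax size x R
    covered : distinct X ⊆ concatMap (λ r → fibre (ψ r) X) R
    covered d∈D = ∈-concatMap⁺ setoid setoid
      (Any.map (λ {r} → ∈-filter⁺ setoid ((ℤ._≟ ψ r) ∘ ψ) (ψ-resp (_≡ ψ r)) d∈D)
               (ψ-Cardinality.distinct⁺ X (Any.map ψ-cong (distinct⁻ X d∈D))))

  ∣ψ∣-nonempty : ∀ x xs → 1 ≤ ∣ψ x ∷ xs ∣
  ∣ψ∣-nonempty x xs = Cardinality.distinctCount-nonempty ℤP.≡-decSetoid (ψ x) (map ψ xs)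

  module _ {p} {Q : ℤ → Set p} (Q? : U.Decidable Q) (X : List Carrier) (w : Carrier) where

    shifted : List Carrier
    shifted = map (_∙ w) (filter (Q? ∘ ψ) (distinct X))

    ∈-shifted⁻ : ∀ {z} → z ∈ shifted → ∃ λ d → d ∈ X × Q (ψ d) × ψ z ≡ ψ d ℤ.+ ψ w × z ≈ d ∙ w
    ∈-shifted⁻ z∈ =
      let d , d∈ , z≈d∙w = ∈-map⁻ setoid setoid z∈
          d∈D , Qd = ∈-filter⁻ setoid (Q? ∘ ψ) (ψ-resp Q) d∈
      in d , distinct⁻ X d∈D , Qd , trans (ψ-cong z≈d∙w) (ψ-homo d w) , z≈d∙w

    shifted-unique : Unique shifted
    shifted-unique = Uniqueₚ.map⁺ setoid setoid (λ {a} {b} → ∙-cancelʳ w a b)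
                       (Uniqueₚ.filter⁺ setoid (Q? ∘ ψ) (distinct-unique X))

    shifted⊆sumset : ∀ {Y} → w ∈ Y → shifted ⊆ sumset X Y
    shifted⊆sumset w∈Y z∈ =
      let d , d∈X , _ , _ , z≈d∙w = ∈-shifted⁻ z∈
      in ∈-resp-≈ setoid (≈-sym z≈d∙w) (∈-sumset⁺ d∈X w∈Y)

  -- X + Y contains the translate of X below level k by an element u of Y of least ψ, the
  -- translates of the fibre of X over k by one element of Y from each ψ-level, and the translate
  -- of X above level k by an element v of Y of largest ψ; these lie in the disjoint ψ-ranges
  -- (−∞, k + ψ u), [k + ψ u, k + ψ v] and (k + ψ v, ∞), and the translates of the fibre in
  -- pairwise different levels.
  module _ (k : ℤ) (X : List Carrier) (y : Carrier) (ys : List Carrier) where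

    private
      Y = y ∷ ys
      D = distinct X
      below? : U.Decidable (ℤ._< k)
      below? = ℤ._<? k
      at? : U.Decidable (_≡ k)
      at? = ℤ._≟ k
      above? : U.Decidable (k ℤ.<_)
      above? = k ℤ.<?_
      D< = filter (below? ∘ ψ) D
      D> = filter (above? ∘ ψ) D
      u = ℤExtrema.argmin ψ y ys
      v = ℤExtrema.argmax ψ y ys
      R = ψ-Cardinality.distinct Y
      block : Carrier → List Carrier
      block = shifted at? X
      low = shifted below? X u
      mid = concatMap block R
      high = shifted above? X v

      ψu≤ : All (λ z → ψ u ℤ.≤ ψ z) Y
      ψu≤ = ℤExtrema.f[argmin]≤f[⊤] {f = ψ} y ys ∷ ℤExtrema.f[argmin]≤f[xs] y ys

      ≤ψv : All (λ z → ψ z ℤ.≤ ψ v) Y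
      ≤ψv = ℤExtrema.f[⊥]≤f[argmax] {f = ψ} y ys ∷ ℤExtrema.f[xs]≤f[argmax] y ys

      sel∈Y : ∀ {w} → (w ≡ y) ⊎ (w ∈ₚ ys) → w ∈ Y
      sel∈Y = [ here ∘ reflexive , there ∘ Any.map reflexive ]′

      ψ-block : ∀ r {z} → z ∈ block r → ψ z ≡ k ℤ.+ ψ r
      ψ-block r z∈block =
        let _ , _ , ψd≡k , ψz≡ψd+ψr , _ = ∈-shifted⁻ at? X r z∈block
        in trans ψz≡ψd+ψr (cong (ℤ._+ ψ r) ψd≡k)

      ∈-mid⁻ : ∀ {z} → z ∈ mid → ∃ λ r → r ∈ Y × z ∈ block r
      ∈-mid⁻ z∈mid =
        let r , r∈R , z∈block = find (∈-concatMap⁻ setoid setoid {xs = R} z∈mid)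
        in r , ψ-Cardinality.distinct⁻ Y r∈R , z∈block

      ψ-low : ∀ {z} → z ∈ low → ψ z ℤ.< k ℤ.+ ψ u
      ψ-low z∈low =
        let _ , _ , ψd<k , ψz≡ψd+ψu , _ = ∈-shifted⁻ below? X u z∈low
        in subst (ℤ._< k ℤ.+ ψ u) (sym ψz≡ψd+ψu) (ℤP.+-monoˡ-< (ψ u) ψd<k)

      ψ-mid : ∀ {z} → z ∈ mid → k ℤ.+ ψ u ℤ.≤ ψ z × ψ z ℤ.≤ k ℤ.+ ψ v
      ψ-mid z∈mid =
        let r , r∈Y , z∈block = ∈-mid⁻ z∈mid
            ψz≡k+ψr = sym (ψ-block r z∈block)
            ψu≤ψr = lookupₛ setoid (ψ-resp (ψ u ℤ.≤_)) ψu≤ r∈Y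
            ψr≤ψv = lookupₛ setoid (ψ-resp (ℤ._≤ ψ v)) ≤ψv r∈Y
        in subst (k ℤ.+ ψ u ℤ.≤_) ψz≡k+ψr (ℤP.+-monoʳ-≤ k ψu≤ψr)
         , subst (ℤ._≤ k ℤ.+ ψ v) ψz≡k+ψr (ℤP.+-monoʳ-≤ k ψr≤ψv)

      ψ-high : ∀ {z} → z ∈ high → k ℤ.+ ψ v ℤ.< ψ z
      ψ-high z∈high =
        let _ , _ , k<ψd , ψz≡ψd+ψv , _ = ∈-shifted⁻ above? X v z∈high
        in subst (k ℤ.+ ψ v ℤ.<_) (sym ψz≡ψd+ψv) (ℤP.+-monoˡ-< (ψ v) k<ψd)

      blocks-disjoint : ∀ {r r′} → ψ r ≢ ψ r′ → Disjoint (block r) (block r′)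
      blocks-disjoint {r} {r′} ψr≢ψr′ (z∈r , z∈r′) =
        ψr≢ψr′ (ℤ-+-cancelˡ k (ψ r) (ψ r′) (trans (sym (ψ-block r z∈r)) (ψ-block r′ z∈r′)))

      U = low ++ (mid ++ high)

      U-unique : Unique U
      U-unique = Uniqueₚ.++⁺ setoid (shifted-unique below? X u)
        (Uniqueₚ.++⁺ setoid mid-unique (shifted-unique above? X v)
           (λ (z∈mid , z∈high) → ℤP.<⇒≱ (ψ-high z∈high) (proj₂ (ψ-mid z∈mid))))
        (λ (z∈low , z∈rest) → ℤP.<⇒≱ (ψ-low z∈low) (rest-≥ (∈-++⁻ setoid mid z∈rest)))
        where
        mid-unique : Unique mid
        mid-unique = Uniqueₚ.concat⁺ setoid (Allₚ.map⁺ (universal (shifted-unique at? X) R))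
                       (AllPairsₚ.map⁺ (AllPairs.map blocks-disjoint (ψ-Cardinality.distinct-unique Y)))
        ψu≤ψv : ψ u ℤ.≤ ψ v
        ψu≤ψv = ℤP.≤-trans (ℤExtrema.f[argmin]≤f[⊤] {f = ψ} y ys) (ℤExtrema.f[⊥]≤f[argmax] {f = ψ} y ys)
        rest-≥ : ∀ {z} → z ∈ mid ⊎ z ∈ high → k ℤ.+ ψ u ℤ.≤ ψ z
        rest-≥ = [ proj₁ ∘ ψ-mid
                 , (λ z∈high → ℤP.<⇒≤ (ℤP.≤-<-trans (ℤP.+-monoʳ-≤ k ψu≤ψv) (ψ-high z∈high))) ]′

      U⊆sumset : U ⊆ sumset X Y
      U⊆sumset z∈U with ∈-++⁻ setoid low z∈U
      ... | inj₁ z∈low = shifted⊆sumset below? X u (sel∈Y (ℤExtrema.argmin-sel ψ y ys)) z∈low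
      ... | inj₂ z∈rest with ∈-++⁻ setoid mid z∈rest
      ...   | inj₁ z∈mid = let r , r∈Y , z∈block = ∈-mid⁻ z∈mid in shifted⊆sumset at? X r r∈Y z∈block
      ...   | inj₂ z∈high = shifted⊆sumset above? X v (sel∈Y (ℤExtrema.argmax-sel ψ y ys)) z∈high

      kept : ∀ {Q : ℤ → Set} (Q? : U.Decidable Q) {z} → z ∈ D → Q (ψ z) → z ∈ filter (Q? ∘ ψ) D
      kept {Q} Q? = ∈-filter⁺ setoid (Q? ∘ ψ) (ψ-resp Q)

      D⊆pieces : D ⊆ D< ++ (fibre k X ++ D>)
      D⊆pieces {z} z∈D with ℤP.<-cmp (ψ z) k
      ... | tri< ψz<k _ _ = ∈-++⁺ˡ setoid (kept below? z∈D ψz<k)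
      ... | tri≈ _ ψz≡k _ = ∈-++⁺ʳ setoid D< (∈-++⁺ˡ setoid (kept at? z∈D ψz≡k))
      ... | tri> _ _ k<ψz = ∈-++⁺ʳ setoid D< (∈-++⁺ʳ setoid (fibre k X) (kept above? z∈D k<ψz))


      length-U : length U ≡ length D< + (length R * length (fibre k X) + length D>)
      length-U = trans (length-++ low) (cong₂ _+_ (length-map _ D<)
        (trans (length-++ mid) (cong₂ _+_ (length-concatMap-map (λ r d → d ∙ r) (fibre k X) R) (length-map _ D>))))

      rearrange : ∀ a b c m → (a + (b + c)) + m ≡ a + ((b + m) + c)
      rearrange = solve-∀

    sumset-fibre-bound : ∣ X ∣ + (∣ψ y ∷ ys ∣ ∸ 1) * length (fibre k X) ≤ ∣ sumset X (y ∷ ys) ∣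
    sumset-fibre-bound = begin
      ∣ X ∣ + (∣ψ Y ∣ ∸ 1) * l₌
        ≡⟨ cong₂ _+_ (sym (length-distinct X)) (cong (λ n → (n ∸ 1) * l₌) (∣ψ∣≡length Y)) ⟩
      length D + (length R ∸ 1) * l₌
        ≤⟨ +-monoˡ-≤ _ (unique⇒length≤ (distinct-unique X) D⊆pieces) ⟩
      length (D< ++ (fibre k X ++ D>)) + (length R ∸ 1) * l₌
        ≡⟨ cong (_+ (length R ∸ 1) * l₌) (trans (length-++ D<) (cong (length D< +_) (length-++ (fibre k X)))) ⟩
      (length D< + (l₌ + length D>)) + (length R ∸ 1) * l₌
        ≡⟨ rearrange (length D<) l₌ (length D>) _ ⟩
      length D< + ((l₌ + (length R ∸ 1) * l₌) + length D>)
        ≡⟨ cong (λ n → length D< + (n * l₌ + length D>)) (m+[n∸m]≡n 1≤∣R∣) ⟩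
      length D< + (length R * l₌ + length D>)
        ≡⟨ sym length-U ⟩
      length U
        ≤⟨ unique⇒length≤distinctCount U-unique U⊆sumset ⟩
      ∣ sumset X Y ∣ ∎
      where
      open ≤-Reasoning
      l₌ = length (fibre k X)
      1≤∣R∣ : 1 ≤ length R
      1≤∣R∣ = subst (1 ≤_) (∣ψ∣≡length Y) (∣ψ∣-nonempty y ys)

  three-sumsets-bound : ∀ x xs y ys →
    let A₁ = x ∷ xs
        A₂ = y ∷ ys
        n₁ = ∣ψ A₁ ∣
        n₂ = ∣ψ A₂ ∣
    in 3 * ((n₁ + n₂) ∸ 1) * (∣ A₁ ∣ + ∣ A₂ ∣)
       ≤ (n₁ + n₂) * (∣ sumset A₁ A₁ ∣ + ∣ sumset A₁ A₂ ∣ + ∣ sumset A₂ A₂ ∣)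
  three-sumsets-bound x xs y ys =
    three-sumsets-inequality (∣ψ∣-nonempty x xs) (∣ψ∣-nonempty y ys)
      (length-fibre≤ k₁ A₁) (length-fibre≤ k₂ A₂) A₁≤n₁α A₂≤n₂β
      (sumset-fibre-bound k₁ A₁ x xs) (sumset-fibre-bound k₁ A₁ y ys)
      (≤-trans (sumset-fibre-bound k₂ A₂ x xs) (sumset-comm-≤ A₁ A₂)) (sumset-fibre-bound k₂ A₂ y ys)
    where
    A₁ = x ∷ xs
    A₂ = y ∷ ys
    k₁ = proj₁ (largest-fibre x xs)
    A₁≤n₁α = proj₂ (largest-fibre x xs)
    k₂ = proj₁ (largest-fibre y ys)
    A₂≤n₂β = proj₂ (largest-fibre y ys)

proposition1 : ∀ {c ℓ} (H : AbelianGroup c ℓ)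
    → (_≟H_ : Decidable (AbelianGroup._≈_ H))
    → Σ (List (AbelianGroup.Carrier H)) (λ enum → ∀ h → Any (AbelianGroup._≈_ H h) enum)
    → (A₁ A₂ : List (Sum.G H))
    → A₁ ≢ []
    → A₂ ≢ []
    → let open Sum H
          open Card _≟H_
          n₁ = ∣ψ A₁ ∣
          n₂ = ∣ψ A₂ ∣
      in 3 * ((n₁ + n₂) ∸ 1) * (∣ A₁ ∣ + ∣ A₂ ∣)
         ≤ (n₁ + n₂) * (∣ sumset A₁ A₁ ∣ + ∣ sumset A₁ A₂ ∣ + ∣ sumset A₂ A₂ ∣)
proposition1 H _≟H_ _ [] _ A₁≢[] _ = contradiction refl A₁≢[]
proposition1 H _≟H_ _ (_ ∷ _) [] _ A₂≢[] = contradiction refl A₂≢[]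
proposition1 H _≟H_ _ (x ∷ xs) (y ∷ ys) _ _ =
  SumsetBounds.three-sumsets-bound (DirectProduct.abelianGroup ℤP.+-0-abelianGroup H)
    (Sum.Card._≟G_ H _≟H_) proj₁ proj₁ (λ _ _ → refl) x xs y ys
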